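{- Let $G$ be a finite simple claw-free graph with minimum degree $\delta(G)\geq 4$ which does not contain $C_4$ as a subgraph. Then every non-cut vertex of $G$ lies on a cycle whose length is a power of $2$.
   Context: A graph is claw-free if it does not contain $K_{1,3}$ as an induced subgraph. A non-cut vertex is a vertex whose removal does not increase the number of connected components. -}

module Defs where

open import Data.Nat using (ℕ; _≤_; _^_; suc)
open import Data.Fin using (Fin)
open import Data.List using (List; length; filter; allFin; _∷_; [])
open import Data.List.Membership.Propositional using (_∈_)
open import Data.List.Relation.Unary.Unique.Propositional using (Unique)
open import Data.Product using (Σ; ∃; _×_; _,_)
open import Data.Empty using (⊥)
open import Relation.Nullary using (¬_; Dec)
open import Relation.Binary.PropositionalEquality using (_≡_; _≢_)

record Graph (n : ℕ) : Set₁ where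
  field
    Adj    : Fin n → Fin n → Set
    adj?   : ∀ u v → Dec (Adj u v)
    sym    : ∀ {u v} → Adj u v → Adj v u
    irrefl : ∀ {u} → ¬ Adj u u

module _ {n : ℕ} (G : Graph n) where
  open Graph G

  degree : Fin n → ℕ
  degree v = length (filter (adj? v) (allFin n))

  MinDegreeAtLeast : ℕ → Set
  MinDegreeAtLeast k = ∀ v → k ≤ degree v

  ClawFree : Set
  ClawFree = ∀ v a b c → Adj v a → Adj v b → Adj v c →
             a ≢ b → a ≢ c → b ≢ c →
             ¬ (¬ Adj a b × ¬ Adj a c × ¬ Adj b c)

  ContainsC4 : Set
  ContainsC4 = Σ (Fin n) λ a → Σ (Fin n) λ b → Σ (Fin n) λ c → Σ (Fin n) λ d →
    Unique (a ∷ b ∷ c ∷ d ∷ []) × Adj a b × Adj b c × Adj c d × Adj d a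

  data Walk (Ok : Fin n → Set) : Fin n → Fin n → Set where
    here : ∀ {x} → Ok x → Walk Ok x x
    step : ∀ {x y z} → Ok x → Adj x y → Walk Ok y z → Walk Ok x z

  Connected : Fin n → Fin n → Set
  Connected = Walk (λ _ → Data.Unit.⊤)
    where import Data.Unit

  ConnectedAvoiding : Fin n → Fin n → Fin n → Set
  ConnectedAvoiding w = Walk (λ u → u ≢ w)

  -- w is a non-cut vertex: deleting w does not increase the number of
  -- connected components, i.e. any two vertices other than w that are
  -- connected in G remain connected in G - w.
  NonCutVertex : Fin n → Set
  NonCutVertex w = ∀ x y → x ≢ w → y ≢ w → Connected x y → ConnectedAvoiding w x y

  data Path : List (Fin n) → Set where
    one  : ∀ v → Path (v ∷ [])
    cons : ∀ {u v vs} → Adj u v → Path (v ∷ vs) → Path (u ∷ v ∷ vs)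

  last : Fin n → List (Fin n) → Fin n
  last x [] = x
  last _ (y ∷ ys) = last y ys

  IsCycle : List (Fin n) → Set
  IsCycle [] = ⊥
  IsCycle (v ∷ vs) = 3 ≤ length (v ∷ vs) × Unique (v ∷ vs) × Path (v ∷ vs) × Adj (last v vs) v

  OnPowerOfTwoCycle : Fin n → Set
  OnPowerOfTwoCycle w = Σ (List (Fin n)) λ C → IsCycle C × w ∈ C × ∃ λ m → length C ≡ 2 ^ m

module Submission where

-- Without a C4, two distinct vertices have at most one common neighbour;
-- with claw-freeness and δ ≥ 4 this puts every edge xy into a triangle xyz.
-- Hence the neighbourhood of v consists of two disjoint edges a a' and b b',
-- and there are no edges between S = {a, a'} and T = {b, b'}.  Since v is
-- not a cut vertex, G − v contains an S–T walk; let p₀ p₁ … p_k be a shortest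
-- one (k ≥ 1).  Being shortest, it has no shortcuts of length ≤ 2 in G − v;
-- this makes the vertices p_i and the apexes z_i of the triangles on its edges
-- p_i p_{i+1} pairwise distinct and different from v.  Replacing the first m
-- edges p_i p_{i+1} by p_i z_i p_{i+1} yields a cycle v p₀ … p_k of length
-- k + 2 + m for every m ≤ k, and the range [k + 2, 2k + 2] contains a power 2ᵉ.

open import Defs
open import Data.Nat using (ℕ; zero; suc; _+_; _*_; _∸_; _^_; _≤_; _<_; z≤n; s≤s; _≤?_)
open import Data.Nat.Properties
  using (≤-refl; ≤-trans; ≤-pred; m≤n⇒m≤1+n; ≤-antisym; <⇒≤; <⇒≱; ≮⇒≥; <-≤-trans; m≤n⇒m<n∨m≡n; <-trans; n≤1+n; n<1+n; +-suc; +-comm; m≤m+n; +-cancelʳ-≤;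
         m+[n∸m]≡n; ∸-monoʳ-<; n<1⇒n≡0; ≰⇒>; anyUpTo?)
open import Data.Nat.Induction using (<-rec)
open import Data.Nat.Tactic.RingSolver using (solve-∀)
open import Data.Fin using (Fin; _≟_)
open import Data.Fin.Properties using (any?)
open import Data.List using (List; []; _∷_; length; filter; allFin)
open import Data.List.Properties using (filter-notAll)
open import Data.List.Membership.Propositional using (_∈_; _∉_)
open import Data.List.Membership.Propositional.Properties using (∈-filter⁺; ∈-filter⁻)
open import Data.List.Relation.Unary.Any as Any using (here; there)
open import Data.List.Relation.Unary.All as All using (All; []; _∷_)
open import Data.List.Relation.Unary.AllPairs using ([]; _∷_)
open import Data.List.Relation.Unary.Unique.Propositional using (Unique)
import Data.List.Relation.Unary.Unique.Propositional.Properties as Unique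
open import Data.Product using (Σ; ∃; _×_; _,_; proj₁; proj₂)
open import Data.Sum using (_⊎_; inj₁; inj₂; [_,_]′)
open import Data.Empty using (⊥; ⊥-elim)
open import Data.Unit using (tt)
open import Function using (_∘_)
open import Relation.Nullary using (¬_; Dec; yes; no)
open import Relation.Nullary.Decidable using (_×-dec_; _⊎-dec_; ¬?; map′)
open import Relation.Binary.Definitions using (DecidableEquality)
open import Relation.Binary.PropositionalEquality using (_≡_; _≢_; refl; sym; trans; cong; subst)

least : ∀ {P : ℕ → Set} → (∀ m → Dec (P m)) → ∀ {m} → P m →
        ∃ λ k → P k × (∀ {j} → P j → k ≤ j)
least {P} P? {m} = <-rec (λ m → P m → ∃ λ k → P k × (∀ {j} → P j → k ≤ j)) search m
  where
  search : ∀ m → (∀ {j} → j < m → P j → ∃ λ k → P k × (∀ {i} → P i → k ≤ i)) →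
           P m → ∃ λ k → P k × (∀ {j} → P j → k ≤ j)
  search m smaller Pm with anyUpTo? P? m
  ... | yes (j , j<m , Pj) = smaller j<m Pj
  ... | no none = m , Pm , λ {j} Pj → ≮⇒≥ (λ j<m → none (j , j<m , Pj))

∸-cancel : ∀ {j k c} → j ≤ k → k ≤ c + (k ∸ j) → j ≤ c
∸-cancel {j} {k} {c} j≤k k≤ = +-cancelʳ-≤ (k ∸ j) j c (subst (_≤ c + (k ∸ j)) (sym (m+[n∸m]≡n j≤k)) k≤)

power-of-two-in-range : ∀ k → ∃ λ e → ∃ λ m → m ≤ k × 2 + k + m ≡ 2 ^ e
power-of-two-in-range zero = 1 , 0 , z≤n , refl
power-of-two-in-range (suc k) with power-of-two-in-range k
... | e , suc m , m<k , eq = e , m , m≤n⇒m≤1+n (<⇒≤ m<k) , trans (cong (2 +_) (sym (+-suc k m))) eq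
... | e , zero , _ , eq = suc e , suc k , ≤-refl , trans (doubling k) (cong (2 *_) eq)
  where
  doubling : ∀ k → 2 + suc k + suc k ≡ 2 * (2 + k + 0)
  doubling = solve-∀

module _ {A : Set} (_≟ᴬ_ : DecidableEquality A) where

  outside : ∀ {xs ys : List A} → Unique xs → length ys < length xs → ∃ λ x → x ∈ xs × x ∉ ys
  outside {x ∷ xs} {ys} (x∉xs ∷ unique-xs) ys<x∷xs with Any.any? (x ≟ᴬ_) ys
  ... | no x∉ys = x , here refl , x∉ys
  ... | yes x∈ys with outside unique-xs ys′<xs
    where
    ys′<xs : length (filter (λ y → ¬? (y ≟ᴬ x)) ys) < length xs
    ys′<xs = <-≤-trans (filter-notAll (λ y → ¬? (y ≟ᴬ x)) ys (Any.map (λ { refl x≢x → x≢x refl }) x∈ys))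
                       (≤-pred ys<x∷xs)
  ... | x′ , x′∈xs , x′∉ys′ =
    x′ , there x′∈xs , λ x′∈ys → x′∉ys′ (∈-filter⁺ (λ y → ¬? (y ≟ᴬ x)) x′∈ys
                                          (λ x′≡x → All.lookup x∉xs x′∈xs (sym x′≡x)))

module _ {n : ℕ} (G : Graph n) where
  open Graph G renaming (sym to adj-sym)

  adjacent⇒distinct : ∀ {x y} → Adj x y → x ≢ y
  adjacent⇒distinct xy refl = irrefl xy

  fresh-neighbour : ∀ x (ys : List (Fin n)) → length ys < degree G x → ∃ λ q → Adj x q × q ∉ ys
  fresh-neighbour x ys short with outside _≟_ (Unique.filter⁺ (adj? x) (Unique.allFin⁺ n)) short
  ... | q , q∈N , q∉ys = q , proj₂ (∈-filter⁻ (adj? x) {xs = allFin n} q∈N) , q∉ys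

  apex : Fin n → Fin n → Fin n
  apex x y with any? (λ z → adj? x z ×-dec adj? z y)
  ... | yes (z , _) = z
  ... | no _ = x

  apex-adj : ∀ {x y} → (∃ λ z → Adj x z × Adj z y) → Adj x (apex x y) × Adj (apex x y) y
  apex-adj {x} {y} common with any? (λ z → adj? x z ×-dec adj? z y)
  ... | yes (_ , xz-zy) = xz-zy
  ... | no none = ⊥-elim (none common)

  common-neighbour-unique : ¬ ContainsC4 G → ∀ {x y z z′} → x ≢ y →
                            Adj x z → Adj z y → Adj x z′ → Adj z′ y → z ≡ z′
  common-neighbour-unique C4-free {x} {y} {z} {z′} x≢y xz zy xz′ z′y with z ≟ z′
  ... | yes z≡z′ = z≡z′
  ... | no z≢z′ = ⊥-elim (C4-free (x , z , y , z′ , distinct , xz , zy , adj-sym z′y , adj-sym xz′))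
    where
    distinct : Unique (x ∷ z ∷ y ∷ z′ ∷ [])
    distinct = (adjacent⇒distinct xz ∷ x≢y ∷ adjacent⇒distinct xz′ ∷ [])
             ∷ (adjacent⇒distinct zy ∷ z≢z′ ∷ [])
             ∷ (adjacent⇒distinct (adj-sym z′y) ∷ [])
             ∷ [] ∷ []

  claw : ClawFree G → ∀ {x a b c} → Adj x a → Adj x b → Adj x c → a ≢ b → a ≢ c → b ≢ c →
         ¬ Adj a b → Adj a c ⊎ Adj b c
  claw claw-free {x} {a} {b} {c} xa xb xc a≢b a≢c b≢c ¬ab with adj? a c | adj? b c
  ... | yes ac | _ = inj₁ ac
  ... | no _ | yes bc = inj₂ bc
  ... | no ¬ac | no ¬bc = ⊥-elim (claw-free x a b c xa xb xc a≢b a≢c b≢c (¬ab , ¬ac , ¬bc))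

  module _ (claw-free : ClawFree G) (min-degree : MinDegreeAtLeast G 4) (C4-free : ¬ ContainsC4 G) where

    -- Three further neighbours q₁ q₂ q₃ of x suffice to find a triangle on the edge xy:
    -- otherwise claws force q₁q₂ and q₁q₃, and x q₂ q₁ q₃ is a 4-cycle.
    triangle-among : ∀ {x y q₁ q₂ q₃} → Adj x y → Adj x q₁ → Adj x q₂ → Adj x q₃ →
                     y ≢ q₁ → y ≢ q₂ → y ≢ q₃ → q₁ ≢ q₂ → q₁ ≢ q₃ → q₂ ≢ q₃ →
                     ∃ λ z → Adj x z × Adj z y
    triangle-among {x} {y} {q₁} {q₂} {q₃} xy xq₁ xq₂ xq₃ y≢q₁ y≢q₂ y≢q₃ q₁≢q₂ q₁≢q₃ q₂≢q₃
      with adj? y q₁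
    ... | yes yq₁ = q₁ , xq₁ , adj-sym yq₁
    ... | no ¬yq₁ with claw claw-free xy xq₁ xq₂ y≢q₁ y≢q₂ q₁≢q₂ ¬yq₁
                     | claw claw-free xy xq₁ xq₃ y≢q₁ y≢q₃ q₁≢q₃ ¬yq₁
    ... | inj₁ yq₂ | _ = q₂ , xq₂ , adj-sym yq₂
    ... | inj₂ _ | inj₁ yq₃ = q₃ , xq₃ , adj-sym yq₃
    ... | inj₂ q₁q₂ | inj₂ q₁q₃ =
      ⊥-elim (C4-free (x , q₂ , q₁ , q₃ , distinct , xq₂ , adj-sym q₁q₂ , q₁q₃ , adj-sym xq₃))
      where
      distinct : Unique (x ∷ q₂ ∷ q₁ ∷ q₃ ∷ [])
      distinct = (adjacent⇒distinct xq₂ ∷ adjacent⇒distinct xq₁ ∷ adjacent⇒distinct xq₃ ∷ [])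
               ∷ ((λ e → q₁≢q₂ (sym e)) ∷ q₂≢q₃ ∷ [])
               ∷ (q₁≢q₃ ∷ [])
               ∷ [] ∷ []

    fresh : ∀ x (ys : List (Fin n)) → length ys < 4 → ∃ λ q → Adj x q × q ∉ ys
    fresh x ys short = fresh-neighbour x ys (<-≤-trans short (min-degree x))

    triangle : ∀ {x y} → Adj x y → ∃ λ z → Adj x z × Adj z y
    triangle {x} {y} xy with fresh x (y ∷ []) (s≤s (s≤s z≤n))
    ... | q₁ , xq₁ , q₁∉ with fresh x (y ∷ q₁ ∷ []) (s≤s (s≤s (s≤s z≤n)))
    ... | q₂ , xq₂ , q₂∉ with fresh x (y ∷ q₁ ∷ q₂ ∷ []) ≤-refl
    ... | q₃ , xq₃ , q₃∉ =
      triangle-among xy xq₁ xq₂ xq₃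
        (λ e → q₁∉ (here (sym e))) (λ e → q₂∉ (here (sym e))) (λ e → q₃∉ (here (sym e)))
        (λ e → q₂∉ (there (here (sym e)))) (λ e → q₃∉ (there (here (sym e))))
        (λ e → q₃∉ (there (there (here (sym e)))))

    module Neighbourhood (v : Fin n) where

      mate : Fin n → Fin n
      mate x = apex v x

      mate-adj : ∀ {x} → Adj v x → Adj v (mate x) × Adj (mate x) x
      mate-adj vx = apex-adj (triangle vx)

      mate-unique : ∀ {x y} → Adj v x → Adj v y → Adj y x → y ≡ mate x
      mate-unique vx vy yx =
        common-neighbour-unique C4-free (adjacent⇒distinct vx) vy yx (proj₁ (mate-adj vx)) (proj₂ (mate-adj vx))

      mate-involutive : ∀ {x} → Adj v x → mate (mate x) ≡ x
      mate-involutive vx = sym (mate-unique (proj₁ (mate-adj vx)) vx (adj-sym (proj₂ (mate-adj vx))))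

      first-neighbour : ∃ λ q → Adj v q × q ∉ []
      first-neighbour = fresh v [] (s≤s z≤n)

      a : Fin n
      a = proj₁ first-neighbour

      va : Adj v a
      va = proj₁ (proj₂ first-neighbour)

      second-neighbour : ∃ λ q → Adj v q × q ∉ a ∷ mate a ∷ []
      second-neighbour = fresh v (a ∷ mate a ∷ []) (s≤s (s≤s (s≤s z≤n)))

      b : Fin n
      b = proj₁ second-neighbour

      vb : Adj v b
      vb = proj₁ (proj₂ second-neighbour)

      b∉S : b ∉ a ∷ mate a ∷ []
      b∉S = proj₂ (proj₂ second-neighbour)

      S T : Fin n → Set
      S x = x ≡ a ⊎ x ≡ mate a
      T x = x ≡ b ⊎ x ≡ mate b

      S? : ∀ x → Dec (S x)
      S? x = (x ≟ a) ⊎-dec (x ≟ mate a)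

      T? : ∀ x → Dec (T x)
      T? x = (x ≟ b) ⊎-dec (x ≟ mate b)

      S⊆N : ∀ {x} → S x → Adj v x
      S⊆N (inj₁ refl) = va
      S⊆N (inj₂ refl) = proj₁ (mate-adj va)

      T⊆N : ∀ {x} → T x → Adj v x
      T⊆N (inj₁ refl) = vb
      T⊆N (inj₂ refl) = proj₁ (mate-adj vb)

      S-mate : ∀ {x} → S x → S (mate x)
      S-mate (inj₁ refl) = inj₂ refl
      S-mate (inj₂ refl) = inj₁ (mate-involutive va)

      -- b was chosen outside S, and S is closed under mate, so neither b nor mate b is in S.
      S∩T=∅ : ∀ {x} → S x → T x → ⊥
      S∩T=∅ x∈S (inj₁ refl) with x∈S
      ... | inj₁ b≡a = b∉S (here b≡a)
      ... | inj₂ b≡a′ = b∉S (there (here b≡a′))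
      S∩T=∅ x∈S (inj₂ refl) with S-mate x∈S
      ... | inj₁ e = b∉S (here (trans (sym (mate-involutive vb)) e))
      ... | inj₂ e = b∉S (there (here (trans (sym (mate-involutive vb)) e)))

      -- An edge from S to T would make its T-end the mate of its S-end.
      no-S-T-edge : ∀ {s t} → S s → T t → ¬ Adj s t
      no-S-T-edge s∈S t∈T st =
        S∩T=∅ (subst S (sym (mate-unique (S⊆N s∈S) (T⊆N t∈T) (adj-sym st))) (S-mate s∈S)) t∈T

      -- By claw-freeness at v, every neighbour of v lies in S or in T.
      N⊆S∪T : ∀ {x} → Adj v x → S x ⊎ T x
      N⊆S∪T {x} vx with x ≟ a | x ≟ b
      ... | yes x≡a | _ = inj₁ (inj₁ x≡a)
      ... | no _ | yes x≡b = inj₂ (inj₁ x≡b)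
      ... | no x≢a | no x≢b
        with claw claw-free va vb vx (λ e → b∉S (here (sym e))) (λ e → x≢a (sym e)) (λ e → x≢b (sym e))
                  (no-S-T-edge (inj₁ refl) (inj₁ refl))
      ... | inj₁ ax = inj₁ (inj₂ (mate-unique va vx (adj-sym ax)))
      ... | inj₂ bx = inj₂ (inj₂ (mate-unique vb vx (adj-sym bx)))

module Walks {n : ℕ} (G : Graph n) (Ok : Fin n → Set) where
  open Graph G using (Adj; adj?)

  -- Walks with exactly ℓ edges whose vertices, except possibly the first, satisfy Ok.
  data Walkₗ : ℕ → Fin n → Fin n → Set where
    stay : ∀ {x} → Walkₗ 0 x x
    move : ∀ {ℓ x y z} → Adj x y → Ok y → Walkₗ ℓ y z → Walkₗ (suc ℓ) x z

  infixr 5 _++_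
  _++_ : ∀ {ℓ ℓ′ x y z} → Walkₗ ℓ x y → Walkₗ ℓ′ y z → Walkₗ (ℓ + ℓ′) x z
  stay ++ w′ = w′
  move xy oy w ++ w′ = move xy oy (w ++ w′)

  from-walk : ∀ {x y} → Walk G Ok x y → ∃ λ ℓ → Walkₗ ℓ x y
  from-walk (here _) = 0 , stay
  from-walk (step _ xy w) = suc (proj₁ (from-walk w)) , move xy (first-ok w) (proj₂ (from-walk w))
    where
    first-ok : ∀ {x y} → Walk G Ok x y → Ok x
    first-ok (here ox) = ox
    first-ok (step ox _ _) = ox

  walk? : (∀ x → Dec (Ok x)) → ∀ ℓ x y → Dec (Walkₗ ℓ x y)
  walk? ok? zero x y = map′ (λ { refl → stay }) (λ { stay → refl }) (x ≟ y)
  walk? ok? (suc ℓ) x y =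
    map′ (λ (_ , xw , ow , w) → move xw ow w) (λ { (move xw ow w) → _ , xw , ow , w })
         (any? λ w → adj? x w ×-dec ok? w ×-dec walk? ok? ℓ w y)

  vertex : ∀ {ℓ x y} → Walkₗ ℓ x y → ℕ → Fin n
  vertex {x = x} w zero = x
  vertex {x = x} stay (suc i) = x
  vertex (move _ _ w) (suc i) = vertex w i

  vertex-end : ∀ {ℓ x y} (w : Walkₗ ℓ x y) → vertex w ℓ ≡ y
  vertex-end stay = refl
  vertex-end (move _ _ w) = vertex-end w

  vertex-adj : ∀ {ℓ x y} (w : Walkₗ ℓ x y) {i} → i < ℓ → Adj (vertex w i) (vertex w (suc i))
  vertex-adj (move xy _ _) {zero} _ = xy
  vertex-adj (move _ _ w) {suc i} (s≤s i<ℓ) = vertex-adj w i<ℓ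

  vertex-ok : ∀ {ℓ x y} → Ok x → (w : Walkₗ ℓ x y) → ∀ i → Ok (vertex w i)
  vertex-ok ox w zero = ox
  vertex-ok ox stay (suc i) = ox
  vertex-ok ox (move _ oy w) (suc i) = vertex-ok oy w i

  prefix : ∀ {ℓ x y} (w : Walkₗ ℓ x y) {i} → i ≤ ℓ → Walkₗ i x (vertex w i)
  prefix w {zero} _ = stay
  prefix (move xy oy w) {suc i} (s≤s i≤ℓ) = move xy oy (prefix w i≤ℓ)

  suffix : ∀ {ℓ x y} (w : Walkₗ ℓ x y) {i} → i ≤ ℓ → Walkₗ (ℓ ∸ i) (vertex w i) y
  suffix w {zero} _ = w
  suffix (move _ _ w) {suc i} (s≤s i≤ℓ) = suffix w i≤ℓ

  module Shortest (ok? : ∀ x → Dec (Ok x)) {S T : Fin n → Set}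
                  (S? : ∀ x → Dec (S x)) (T? : ∀ x → Dec (T x)) where

    Connects : ℕ → Set
    Connects ℓ = Σ (Fin n) λ s → S s × Σ (Fin n) λ t → T t × Walkₗ ℓ s t

    connects? : ∀ ℓ → Dec (Connects ℓ)
    connects? ℓ = any? λ s → S? s ×-dec any? λ t → T? t ×-dec walk? ok? ℓ s t

    record ShortestWalk : Set where
      field
        k        : ℕ
        source   : Fin n
        target   : Fin n
        source∈S : S source
        target∈T : T target
        walk     : Walkₗ k source target
        minimal  : ∀ {ℓ} → Connects ℓ → k ≤ ℓ

    shortest-walk : ∀ {ℓ} → Connects ℓ → ShortestWalk
    shortest-walk c with least connects? c
    ... | k , (s , s∈S , t , t∈T , w) , min = record
      { k = k ; source = s ; target = t ; source∈S = s∈S ; target∈T = t∈T ; walk = w ; minimal = min }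

    module Geodesic (g : ShortestWalk) where
      open ShortestWalk g public

      p : ℕ → Fin n
      p = vertex walk

      shortcut-free : ∀ {i j ℓ} → i ≤ k → j ≤ k → Walkₗ ℓ (p i) (p j) → j ≤ ℓ + i
      shortcut-free {i} {j} {ℓ} i≤k j≤k w =
        subst (j ≤_) (+-comm i ℓ) (∸-cancel j≤k (minimal (source , source∈S , target , target∈T ,
                                                          (prefix walk i≤k ++ w) ++ suffix walk j≤k)))

      S-only-at-start : ∀ {i} → i ≤ k → S (p i) → i ≡ 0
      S-only-at-start {zero} _ _ = refl
      S-only-at-start {suc i} i≤k s =
        ⊥-elim (<⇒≱ (∸-monoʳ-< (s≤s z≤n) i≤k) (minimal (p (suc i) , s , target , target∈T , suffix walk i≤k)))

      T-only-at-end : ∀ {i} → i ≤ k → T (p i) → k ≤ i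
      T-only-at-end {i} i≤k t = minimal (source , source∈S , p i , t , prefix walk i≤k)

      nontrivial : (∀ {x} → S x → T x → ⊥) → 1 ≤ k
      nontrivial S∩T=∅ with 1 ≤? k
      ... | yes 1≤k = 1≤k
      ... | no 1≰k = ⊥-elim (S∩T=∅ source∈S (subst T (trans (sym (vertex-end walk)) (cong p k≡0)) target∈T))
        where
        k≡0 : k ≡ 0
        k≡0 = n<1⇒n≡0 (≰⇒> 1≰k)

module Detour {n : ℕ} (G : Graph n) where
  open Graph G using (Adj)

  -- detour p z r m = p₀ z₀ p₁ z₁ … p_{m-1} z_{m-1} p_m p_{m+1} … p_r
  detour : (p z : ℕ → Fin n) → ℕ → ℕ → List (Fin n)
  detour-tail : (p z : ℕ → Fin n) → ℕ → ℕ → List (Fin n)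
  detour p z r m = p 0 ∷ detour-tail p z r m
  detour-tail p z zero m = []
  detour-tail p z (suc r) zero = detour (p ∘ suc) (z ∘ suc) r zero
  detour-tail p z (suc r) (suc m) = z 0 ∷ detour (p ∘ suc) (z ∘ suc) r m

  detour-length : ∀ p z r m → m ≤ r → length (detour p z r m) ≡ suc r + m
  detour-length p z zero .zero z≤n = refl
  detour-length p z (suc r) zero _ = cong suc (detour-length (p ∘ suc) (z ∘ suc) r zero z≤n)
  detour-length p z (suc r) (suc m) (s≤s m≤r) =
    cong (λ t → suc (suc t)) (trans (detour-length (p ∘ suc) (z ∘ suc) r m m≤r) (sym (+-suc r m)))

  detour-last : ∀ p z r m x → last G x (detour p z r m) ≡ p r
  detour-last p z zero m x = refl
  detour-last p z (suc r) zero x = detour-last (p ∘ suc) (z ∘ suc) r zero (p 0)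
  detour-last p z (suc r) (suc m) x = detour-last (p ∘ suc) (z ∘ suc) r m (z 0)

  detour-path : ∀ p z r m → (∀ {i} → i < r → Adj (p i) (p (suc i))) →
                (∀ {i} → i < r → Adj (p i) (z i) × Adj (z i) (p (suc i))) → Path G (detour p z r m)
  detour-path p z zero m _ _ = one (p 0)
  detour-path p z (suc r) zero pp pz =
    cons (pp (s≤s z≤n)) (detour-path (p ∘ suc) (z ∘ suc) r zero (pp ∘ s≤s) (pz ∘ s≤s))
  detour-path p z (suc r) (suc m) pp pz =
    cons (proj₁ (pz (s≤s z≤n))) (cons (proj₂ (pz (s≤s z≤n)))
      (detour-path (p ∘ suc) (z ∘ suc) r m (pp ∘ s≤s) (pz ∘ s≤s)))

  DetourVertex : (p z : ℕ → Fin n) → ℕ → Fin n → Set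
  DetourVertex p z r y = (∃ λ j → j ≤ r × y ≡ p j) ⊎ (∃ λ j → j < r × y ≡ z j)

  shift : ∀ {p z r y} → DetourVertex (p ∘ suc) (z ∘ suc) r y → DetourVertex p z (suc r) y
  shift (inj₁ (j , j≤r , e)) = inj₁ (suc j , s≤s j≤r , e)
  shift (inj₂ (j , j<r , e)) = inj₂ (suc j , s≤s j<r , e)

  detour-∈ : ∀ p z r m {y} → y ∈ detour p z r m → DetourVertex p z r y
  detour-∈ p z r m (here y≡p₀) = inj₁ (0 , z≤n , y≡p₀)
  detour-∈ p z (suc r) zero (there y∈) = shift (detour-∈ (p ∘ suc) (z ∘ suc) r zero y∈)
  detour-∈ p z (suc r) (suc m) (there (here y≡z₀)) = inj₂ (0 , s≤s z≤n , y≡z₀)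
  detour-∈ p z (suc r) (suc m) (there (there y∈)) = shift (detour-∈ (p ∘ suc) (z ∘ suc) r m y∈)

  detour-avoids : ∀ p z r m {x} → (∀ {j} → j ≤ r → x ≢ p j) → (∀ {j} → j < r → x ≢ z j) →
                  All (x ≢_) (detour p z r m)
  detour-avoids p z r m {x} x≢p x≢z = All.tabulate λ y∈ → avoid (detour-∈ p z r m y∈)
    where
    avoid : ∀ {y} → DetourVertex p z r y → x ≢ y
    avoid (inj₁ (j , j≤r , refl)) = x≢p j≤r
    avoid (inj₂ (j , j<r , refl)) = x≢z j<r

  record Distinct (p z : ℕ → Fin n) (r : ℕ) : Set where
    field
      p-injective : ∀ {i j} → i < j → j ≤ r → p i ≢ p j
      z-injective : ∀ {i j} → i < j → j < r → z i ≢ z j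
      p≢z         : ∀ {i j} → i ≤ r → j < r → p i ≢ z j

  module _ {p z : ℕ → Fin n} {r : ℕ} (distinct : Distinct p z (suc r)) where
    open Distinct distinct

    distinct-tail : Distinct (p ∘ suc) (z ∘ suc) r
    distinct-tail = record
      { p-injective = λ i<j j≤r → p-injective (s≤s i<j) (s≤s j≤r)
      ; z-injective = λ i<j j<r → z-injective (s≤s i<j) (s≤s j<r)
      ; p≢z         = λ i≤r j<r → p≢z (s≤s i≤r) (s≤s j<r) }

    p₀-avoids : ∀ m → All (p 0 ≢_) (detour (p ∘ suc) (z ∘ suc) r m)
    p₀-avoids m = detour-avoids (p ∘ suc) (z ∘ suc) r m
                    (λ j≤r → p-injective (s≤s z≤n) (s≤s j≤r)) (λ j<r → p≢z z≤n (s≤s j<r))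

    z₀-avoids : ∀ m → All (z 0 ≢_) (detour (p ∘ suc) (z ∘ suc) r m)
    z₀-avoids m = detour-avoids (p ∘ suc) (z ∘ suc) r m
                    (λ j≤r z₀≡p → p≢z (s≤s j≤r) (s≤s z≤n) (sym z₀≡p)) (λ j<r → z-injective (s≤s z≤n) (s≤s j<r))

  detour-unique : ∀ p z r m → Distinct p z r → Unique (detour p z r m)
  detour-unique p z zero m _ = [] ∷ []
  detour-unique p z (suc r) zero distinct =
    p₀-avoids distinct zero ∷ detour-unique (p ∘ suc) (z ∘ suc) r zero (distinct-tail distinct)
  detour-unique p z (suc r) (suc m) distinct =
    (Distinct.p≢z distinct z≤n (s≤s z≤n) ∷ p₀-avoids distinct m) ∷ z₀-avoids distinct m
      ∷ detour-unique (p ∘ suc) (z ∘ suc) r m (distinct-tail distinct)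

module CycleThrough {n : ℕ} (G : Graph n) (claw-free : ClawFree G) (min-degree : MinDegreeAtLeast G 4)
                    (C4-free : ¬ ContainsC4 G) (v : Fin n) (non-cut : NonCutVertex G v) where
  open Graph G renaming (sym to adj-sym)
  open Neighbourhood G claw-free min-degree C4-free v
  open Walks G (_≢ v)
  open Shortest (λ x → ¬? (x ≟ v)) S? T?
  open Detour G

  -- As v is not a cut vertex, the path a v b can be rerouted through G − v.
  S-T-walk : ∃ λ ℓ → Connects ℓ
  S-T-walk = ℓ , a , inj₁ refl , b , inj₁ refl , w
    where
    rerouted : ConnectedAvoiding G v a b
    rerouted = non-cut a b (λ a≡v → adjacent⇒distinct G va (sym a≡v)) (λ b≡v → adjacent⇒distinct G vb (sym b≡v))
                       (step tt (adj-sym va) (step tt vb (here tt)))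
    ℓ : ℕ
    ℓ = proj₁ (from-walk rerouted)
    w : Walkₗ ℓ a b
    w = proj₂ (from-walk rerouted)

  geodesic : ShortestWalk
  geodesic = shortest-walk (proj₂ S-T-walk)

  -- Along a shortest S–T walk p₀ … p_k in G − v; taking the walk as a parameter keeps
  -- the type checker from unfolding the search that produced it.
  module Along (g : ShortestWalk) where
    open Geodesic g public

    z : ℕ → Fin n
    z i = apex G (p i) (p (suc i))

    p-adj : ∀ {i} → i < k → Adj (p i) (p (suc i))
    p-adj = vertex-adj walk

    z-adj : ∀ {i} → i < k → Adj (p i) (z i) × Adj (z i) (p (suc i))
    z-adj i<k = apex-adj G (triangle G claw-free min-degree C4-free (p-adj i<k))

    p≢v : ∀ i → p i ≢ v
    p≢v = vertex-ok (λ source≡v → adjacent⇒distinct G (S⊆N source∈S) (sym source≡v)) walk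

    pₖ∈T : T (p k)
    pₖ∈T = subst T (sym (vertex-end walk)) target∈T

    -- An apex z_i = v would put the edge p_i p_{i+1} inside N(v), i.e. inside S, inside T,
    -- or between S and T; the first two contradict minimality, the last has no edges.
    z≢v : ∀ {i} → i < k → z i ≢ v
    z≢v {i} i<k z≡v with N⊆S∪T (adj-sym (subst (Adj (p i)) z≡v (proj₁ (z-adj i<k))))
                       | N⊆S∪T (subst (λ q → Adj q (p (suc i))) z≡v (proj₂ (z-adj i<k)))
    ... | inj₂ pᵢ∈T | _ = <⇒≱ i<k (T-only-at-end (<⇒≤ i<k) pᵢ∈T)
    ... | inj₁ pᵢ∈S | inj₂ pᵢ₊₁∈T = no-S-T-edge pᵢ∈S pᵢ₊₁∈T (p-adj i<k)
    ... | inj₁ _ | inj₁ pᵢ₊₁∈S with S-only-at-start i<k pᵢ₊₁∈S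
    ...   | ()

    -- A repetition p_i = p_j (i < j) would be a shortcut of length 0.
    p-injective : ∀ {i j} → i < j → j ≤ k → p i ≢ p j
    p-injective {i} i<j j≤k pᵢ≡pⱼ =
      <⇒≱ i<j (shortcut-free (<⇒≤ (<-≤-trans i<j j≤k)) j≤k (subst (Walkₗ 0 (p i)) pᵢ≡pⱼ stay))

    chord : ∀ {i j} → i ≤ k → j ≤ k → Adj (p i) (p j) → j ≤ suc i
    chord {j = j} i≤k j≤k pᵢpⱼ = shortcut-free i≤k j≤k (move pᵢpⱼ (p≢v j) stay)

    -- An apex z_i = p_j would be adjacent to p_i and p_{i+1}, so j ∈ {i, i+1} by chord;
    -- either way p_j would be adjacent to itself.
    p≢z : ∀ {j i} → j ≤ k → i < k → p j ≢ z i
    p≢z {j} {i} j≤k i<k pⱼ≡zᵢ =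
      [ (λ i<j → irrefl (subst (λ q → Adj (p q) (p (suc i))) (sym (≤-antisym i<j (chord (<⇒≤ i<k) j≤k pᵢpⱼ))) pⱼpᵢ₊₁))
      , (λ i≡j → irrefl (subst (λ q → Adj (p q) (p j)) i≡j pᵢpⱼ))
      ]′ (m≤n⇒m<n∨m≡n (≤-pred (chord j≤k i<k pⱼpᵢ₊₁)))
      where
      pᵢpⱼ : Adj (p i) (p j)
      pᵢpⱼ = subst (Adj (p i)) (sym pⱼ≡zᵢ) (proj₁ (z-adj i<k))
      pⱼpᵢ₊₁ : Adj (p j) (p (suc i))
      pⱼpᵢ₊₁ = subst (λ q → Adj q (p (suc i))) (sym pⱼ≡zᵢ) (proj₂ (z-adj i<k))

    -- Consecutive apexes differ: otherwise z_i and p_{i+1} are two common neighbours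
    -- of p_i and p_{i+2}.
    z-consecutive : ∀ {i} → suc i < k → z i ≢ z (suc i)
    z-consecutive {i} i+1<k zᵢ≡zᵢ₊₁ =
      p≢z (<⇒≤ i+1<k) i<k (common-neighbour-unique G C4-free (p-injective (s≤s (n≤1+n i)) i+1<k)
                             (p-adj i<k) (p-adj i+1<k) (proj₁ (z-adj i<k)) zᵢpᵢ₊₂)
      where
      i<k : i < k
      i<k = <-trans (n<1+n i) i+1<k
      zᵢpᵢ₊₂ : Adj (z i) (p (suc (suc i)))
      zᵢpᵢ₊₂ = subst (λ q → Adj q (p (suc (suc i)))) (sym zᵢ≡zᵢ₊₁) (proj₂ (z-adj i+1<k))

    -- If z_i = z_j with i < j, then p_i z_i p_{j+1} is a walk of length 2, so j = i + 1.
    z-injective : ∀ {i j} → i < j → j < k → z i ≢ z j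
    z-injective {i} {j} i<j j<k zᵢ≡zⱼ =
      z-consecutive (subst (_< k) j≡i+1 j<k) (trans zᵢ≡zⱼ (cong z j≡i+1))
      where
      i<k : i < k
      i<k = <-trans i<j j<k
      zᵢpⱼ₊₁ : Adj (z i) (p (suc j))
      zᵢpⱼ₊₁ = subst (λ q → Adj q (p (suc j))) (sym zᵢ≡zⱼ) (proj₂ (z-adj j<k))
      j≡i+1 : j ≡ suc i
      j≡i+1 = sym (≤-antisym i<j (≤-pred (shortcut-free (<⇒≤ i<k) j<k
                                   (move (proj₁ (z-adj i<k)) (z≢v i<k) (move zᵢpⱼ₊₁ (p≢v (suc j)) stay)))))

    distinct : Distinct p z k
    distinct = record { p-injective = p-injective ; z-injective = z-injective ; p≢z = p≢z }

    cycle : ℕ → List (Fin n)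
    cycle m = v ∷ detour p z k m

    cycle-length : ∀ {m} → m ≤ k → length (cycle m) ≡ 2 + k + m
    cycle-length m≤k = cong suc (detour-length p z k _ m≤k)

    is-cycle : ∀ {m} → m ≤ k → IsCycle G (cycle m)
    is-cycle {m} m≤k = long , unique , path , closing
      where
      long : 3 ≤ length (cycle m)
      long = subst (3 ≤_) (sym (cycle-length m≤k)) (s≤s (s≤s (≤-trans (nontrivial S∩T=∅) (m≤m+n k m))))
      unique : Unique (cycle m)
      unique = detour-avoids p z k m (λ {j} _ v≡pⱼ → p≢v j (sym v≡pⱼ)) (λ j<k v≡zⱼ → z≢v j<k (sym v≡zⱼ))
             ∷ detour-unique p z k m distinct
      path : Path G (cycle m)
      path = cons (S⊆N source∈S) (detour-path p z k m p-adj z-adj)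
      closing : Adj (last G v (detour p z k m)) v
      closing = subst (λ q → Adj q v) (sym (detour-last p z k m v)) (adj-sym (T⊆N pₖ∈T))

theorem5 : ∀ {n : ℕ} (G : Graph n) → ClawFree G → MinDegreeAtLeast G 4 →
           ¬ ContainsC4 G → ∀ (v : Fin n) → NonCutVertex G v →
           OnPowerOfTwoCycle G v
theorem5 G claw-free min-degree C4-free v non-cut =
  let (e , m , m≤k , 2+k+m≡2ᵉ) = power-of-two-in-range k
  in cycle m , is-cycle m≤k , here refl , e , trans (cycle-length m≤k) 2+k+m≡2ᵉ
  where
  open CycleThrough G claw-free min-degree C4-free v non-cut
  open Along geodesic
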